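{- Let $m\ge 0$ be an integer, $s$ a parameter, and $$l_n(x,m,s)=\sum_{k=0}^{\lfloor n/2\rfloor}\frac{n!}{k!\,(n-2k)!}\,\frac{1}{\prod_{j=1}^{k}(m+n-j)}\,s^k x^{n-2k}.$$ Then for every $n\ge 0$, $$x^n=\sum_{k=0}^{\lfloor n/2\rfloor}\frac{n!}{k!\,(n-2k)!}\,\frac{(n+m-2k)!}{(n+m-k)!}\,(-s)^k\,l_{n-2k}(x,m,s).$$ Consequently, if $\Lambda_m$ is the linear functional on polynomials in $x$ defined by $\Lambda_m(l_n(x,m,s))=[n=0]$, then $\Lambda_m(x^{2n+1})=0$ and $$\Lambda_m(x^{2n})=(-s)^n\,\frac{(2n)!\,m!}{n!\,(m+n)!}\qquad(n\ge 0).$$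
   Context: $[n=0]$ equals $1$ if $n=0$ and $0$ otherwise. Empty products equal $1$. -}

module Defs where

open import Data.Nat as ℕ using (ℕ; zero; suc; _∸_; _!; ⌊_/2⌋)
open import Data.Integer using (+_)
open import Data.Rational using (ℚ; 0ℚ; 1ℚ; _+_; _*_; -_; _/_)
open import Data.List using (List; []; _∷_; map)
open import Relation.Binary.PropositionalEquality using (_≡_)

_^ℚ_ : ℚ → ℕ → ℚ
q ^ℚ zero = 1ℚ
q ^ℚ suc k = q * (q ^ℚ k)

-- a / b as a rational number; only used with b ≠ 0 (convention: a/0 := 0)
frac : ℕ → ℕ → ℚ
frac a zero = 0ℚ
frac a (suc b) = (+ a) / suc b

δ : ℕ → ℚ
δ zero = 1ℚ
δ (suc _) = 0ℚ

prodD : ℕ → ℕ → ℕ → ℕ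
prodD m n zero = 1
prodD m n (suc k) = prodD m n k ℕ.* (m ℕ.+ n ∸ suc k)

-- Polynomials in x with rational coefficients: coefficient list,
-- index i = coefficient of x^i
Poly : Set
Poly = List ℚ

coeff : Poly → ℕ → ℚ
coeff [] i = 0ℚ
coeff (c ∷ p) zero = c
coeff (c ∷ p) (suc i) = coeff p i

-- equality of polynomials (coefficientwise; insensitive to trailing zeros)
_≈ₚ_ : Poly → Poly → Set
p ≈ₚ q = ∀ i → coeff p i ≡ coeff q i

_+ₚ_ : Poly → Poly → Poly
[] +ₚ q = q
(c ∷ p) +ₚ [] = c ∷ p
(c ∷ p) +ₚ (d ∷ q) = (c + d) ∷ (p +ₚ q)

_·ₚ_ : ℚ → Poly → Poly
c ·ₚ p = map (c *_) p

xpow : ℕ → Poly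
xpow zero = 1ℚ ∷ []
xpow (suc n) = 0ℚ ∷ xpow n

sumP : ℕ → (ℕ → Poly) → Poly
sumP zero f = f 0
sumP (suc N) f = sumP N f +ₚ f (suc N)

lPoly : ℕ → ℕ → ℚ → Poly
lPoly n m s = sumP ⌊ n /2⌋ (λ k →
  (frac (n !) ((k !) ℕ.* ((n ∸ 2 ℕ.* k) !) ℕ.* prodD m n k) * (s ^ℚ k)) ·ₚ xpow (n ∸ 2 ℕ.* k))

record IsLinear (Λ : Poly → ℚ) : Set where
  field
    respects : ∀ p q → p ≈ₚ q → Λ p ≡ Λ q
    additive : ∀ p q → Λ (p +ₚ q) ≡ Λ p + Λ q
    homogeneous : ∀ c p → Λ (c ·ₚ p) ≡ c * Λ p

-- Compare coefficients of x^i on both sides of the expansion. The double sum over (k, t)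
-- contributes only along the antidiagonal k + t = j, where n = i + 2j, so the coefficient is
--   (n! s^j / (j! i!)) Σ_{k ≤ j} (-1)^k C(j,k) (M+2t) (M+t-1)! / (M+t+j)!     (t = j - k, M = m + i),
-- which is 1 for j = 0 and otherwise telescopes to 0: without its sign the k-th summand is
-- h(k) + h(k+1) with h(k) = C(j-1,k-1) (M+j-k)! / (M+2j-k)!, since k(M+t) + t(M+t+j) = j(M+2t).
-- Applying Λ to the expansion of x^n leaves only the term with n - 2k = 0.

module Submission where

open import Defs
open import Data.Nat as ℕ using (ℕ; zero; suc; _∸_; _!; ⌊_/2⌋; _≤_; _<_; z≤n; s≤s)
import Data.Nat.Properties as ℕP
open import Data.Integer using (+_)
import Data.Integer as ℤ
import Data.Integer.Properties as ℤP
open import Data.Rational using (ℚ; 0ℚ; 1ℚ; _+_; _*_; -_; fromℚᵘ)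
import Data.Rational.Properties as ℚP
open import Data.Rational.Solver using (module +-*-Solver)
import Data.Rational.Unnormalised as ℚᵘ
import Data.Rational.Unnormalised.Properties as ℚᵘP
import Data.Nat.Tactic.RingSolver as ℕSolver
open import Data.List using ([]; _∷_)
open import Data.Product using (∃-syntax; _,_; _×_)
open import Data.Sum using (_⊎_; inj₁; inj₂)
open import Function using (_∘_)
open import Relation.Nullary using (contradiction)
open import Relation.Binary.PropositionalEquality

fromℚᵘ-homo-+ : ∀ p q → fromℚᵘ (p ℚᵘ.+ q) ≡ fromℚᵘ p + fromℚᵘ q
fromℚᵘ-homo-+ p q = ℚP.toℚᵘ-injective (ℚᵘP.≃-trans (ℚP.toℚᵘ-fromℚᵘ (p ℚᵘ.+ q))
  (ℚᵘP.≃-sym (ℚᵘP.≃-trans (ℚP.toℚᵘ-homo-+ (fromℚᵘ p) (fromℚᵘ q))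
    (ℚᵘP.+-cong (ℚP.toℚᵘ-fromℚᵘ p) (ℚP.toℚᵘ-fromℚᵘ q)))))

fromℚᵘ-homo-* : ∀ p q → fromℚᵘ (p ℚᵘ.* q) ≡ fromℚᵘ p * fromℚᵘ q
fromℚᵘ-homo-* p q = ℚP.toℚᵘ-injective (ℚᵘP.≃-trans (ℚP.toℚᵘ-fromℚᵘ (p ℚᵘ.* q))
  (ℚᵘP.≃-sym (ℚᵘP.≃-trans (ℚP.toℚᵘ-homo-* (fromℚᵘ p) (fromℚᵘ q))
    (ℚᵘP.*-cong (ℚP.toℚᵘ-fromℚᵘ p) (ℚP.toℚᵘ-fromℚᵘ q)))))

frac-0 : ∀ b → frac 0 b ≡ 0ℚ
frac-0 zero    = refl
frac-0 (suc b) = ℚP.0/n≡0 (suc b)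

frac-cong : ∀ {a b c d} → 0 < b → 0 < d → a ℕ.* d ≡ c ℕ.* b → frac a b ≡ frac c d
frac-cong {a} {suc b} {c} {suc d} _ _ eq =
  ℚP.fromℚᵘ-cong {ℚᵘ.mkℚᵘ (+ a) b} {ℚᵘ.mkℚᵘ (+ c) d} (ℚᵘ.*≡*
    (trans (sym (ℤP.pos-* a (suc d))) (trans (cong +_ eq) (ℤP.pos-* c (suc b)))))

frac-* : ∀ a b c d → frac a b * frac c d ≡ frac (a ℕ.* c) (b ℕ.* d)
frac-* a zero    c d       = ℚP.*-zeroˡ (frac c d)
frac-* a (suc b) c zero    rewrite ℕP.*-zeroʳ b = ℚP.*-zeroʳ (frac a (suc b))
frac-* a (suc b) c (suc d) =
  trans (sym (fromℚᵘ-homo-* (ℚᵘ.mkℚᵘ (+ a) b) (ℚᵘ.mkℚᵘ (+ c) d)))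
        (cong (λ x → fromℚᵘ (ℚᵘ.mkℚᵘ x (d ℕ.+ b ℕ.* suc d))) (sym (ℤP.pos-* a c)))

frac-+ : ∀ a b c d → 0 < b → 0 < d → frac a b + frac c d ≡ frac (a ℕ.* d ℕ.+ c ℕ.* b) (b ℕ.* d)
frac-+ a (suc b) c (suc d) _ _ =
  trans (sym (fromℚᵘ-homo-+ (ℚᵘ.mkℚᵘ (+ a) b) (ℚᵘ.mkℚᵘ (+ c) d)))
        (cong (λ x → fromℚᵘ (ℚᵘ.mkℚᵘ x (d ℕ.+ b ℕ.* suc d)))
          (trans (cong₂ ℤ._+_ (sym (ℤP.pos-* a (suc d))) (sym (ℤP.pos-* c (suc b))))
                 (sym (ℤP.pos-+ (a ℕ.* suc d) (c ℕ.* suc b)))))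

∑≤ : ℕ → (ℕ → ℚ) → ℚ
∑≤ zero    f = f 0
∑≤ (suc N) f = ∑≤ N f + f (suc N)

syntax ∑≤ N (λ k → e) = ∑[ k ≤ N ] e

∑≤-cong : ∀ N {f g} → (∀ k → k ≤ N → f k ≡ g k) → ∑≤ N f ≡ ∑≤ N g
∑≤-cong zero    f≗g = f≗g 0 z≤n
∑≤-cong (suc N) f≗g =
  cong₂ _+_ (∑≤-cong N (λ k k≤N → f≗g k (ℕP.m≤n⇒m≤1+n k≤N))) (f≗g (suc N) ℕP.≤-refl)

∑≤-zero : ∀ N {f} → (∀ k → k ≤ N → f k ≡ 0ℚ) → ∑≤ N f ≡ 0ℚ
∑≤-zero N f≗0 = trans (∑≤-cong N f≗0) (zeros N)
  where
  zeros : ∀ N → ∑[ k ≤ N ] 0ℚ ≡ 0ℚ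
  zeros zero    = refl
  zeros (suc N) = cong (_+ 0ℚ) (zeros N)

*-distribˡ-∑≤ : ∀ c N f → c * ∑≤ N f ≡ ∑[ k ≤ N ] (c * f k)
*-distribˡ-∑≤ c zero    f = refl
*-distribˡ-∑≤ c (suc N) f =
  trans (ℚP.*-distribˡ-+ c (∑≤ N f) (f (suc N))) (cong (_+ c * f (suc N)) (*-distribˡ-∑≤ c N f))

∑≤-truncate : ∀ {j N} f → j ≤ N → (∀ k → j < k → k ≤ N → f k ≡ 0ℚ) → ∑≤ N f ≡ ∑≤ j f
∑≤-truncate f j≤N tail≡0 with ℕP.m≤n⇒m<n∨m≡n j≤N
... | inj₂ refl = refl
∑≤-truncate {j} {suc N} f j≤N tail≡0 | inj₁ (s≤s j≤N′) =
  trans (cong₂ _+_ (∑≤-truncate f j≤N′ (λ k j<k k≤N → tail≡0 k j<k (ℕP.m≤n⇒m≤1+n k≤N)))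
                   (tail≡0 (suc N) (s≤s j≤N′) ℕP.≤-refl))
        (ℚP.+-identityʳ (∑≤ j f))

∑≤-single : ∀ {N} k₀ f → k₀ ≤ N → (∀ k → k ≤ N → k ≢ k₀ → f k ≡ 0ℚ) → ∑≤ N f ≡ f k₀
∑≤-single {N} k₀ f k₀≤N others≡0 =
  trans (∑≤-truncate f k₀≤N (λ k k₀<k k≤N → others≡0 k k≤N (ℕP.>⇒≢ k₀<k))) (below k₀ ℕP.≤-refl)
  where
  below : ∀ j → j ≤ k₀ → ∑≤ j f ≡ f j
  below zero    _    = refl
  below (suc j) j<k₀ =
    trans (cong (_+ f (suc j)) (∑≤-zero j (λ k k≤j → others≡0 k
                                  (ℕP.≤-trans (ℕP.≤-trans k≤j (ℕP.n≤1+n j)) (ℕP.≤-trans j<k₀ k₀≤N))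
                                  (ℕP.<⇒≢ (ℕP.<-≤-trans (s≤s k≤j) j<k₀)))))
          (ℚP.+-identityˡ (f (suc j)))

open +-*-Solver

sgn : ℕ → ℚ
sgn zero    = 1ℚ
sgn (suc k) = - sgn k

∑≤-alternating-telescope : ∀ N (h : ℕ → ℚ) → ∑[ k ≤ N ] (sgn k * (h k + h (suc k))) ≡ h 0 + sgn N * h (suc N)
∑≤-alternating-telescope zero    h =
  solve 2 (λ a b → con 1ℚ :* (a :+ b) := a :+ con 1ℚ :* b) refl (h 0) (h 1)
∑≤-alternating-telescope (suc N) h =
  trans (cong (_+ sgn (suc N) * (h (suc N) + h (suc (suc N)))) (∑≤-alternating-telescope N h))
        (solve 4 (λ a σ b c → (a :+ σ :* b) :+ (:- σ) :* (b :+ c) := a :+ (:- σ) :* c)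
               refl (h 0) (sgn N) (h (suc N)) (h (suc (suc N))))

coeff-+ₚ : ∀ p q i → coeff (p +ₚ q) i ≡ coeff p i + coeff q i
coeff-+ₚ []      q       i       = sym (ℚP.+-identityˡ (coeff q i))
coeff-+ₚ (c ∷ p) []      zero    = sym (ℚP.+-identityʳ c)
coeff-+ₚ (c ∷ p) []      (suc i) = sym (ℚP.+-identityʳ (coeff p i))
coeff-+ₚ (c ∷ p) (d ∷ q) zero    = refl
coeff-+ₚ (c ∷ p) (d ∷ q) (suc i) = coeff-+ₚ p q i

coeff-·ₚ : ∀ c p i → coeff (c ·ₚ p) i ≡ c * coeff p i
coeff-·ₚ c []      i       = sym (ℚP.*-zeroʳ c)
coeff-·ₚ c (d ∷ p) zero    = refl
coeff-·ₚ c (d ∷ p) (suc i) = coeff-·ₚ c p i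

coeff-sumP : ∀ N f i → coeff (sumP N f) i ≡ ∑[ k ≤ N ] coeff (f k) i
coeff-sumP zero    f i = refl
coeff-sumP (suc N) f i =
  trans (coeff-+ₚ (sumP N f) (f (suc N)) i) (cong (_+ coeff (f (suc N)) i) (coeff-sumP N f i))

coeff-xpow-≡ : ∀ i → coeff (xpow i) i ≡ 1ℚ
coeff-xpow-≡ zero    = refl
coeff-xpow-≡ (suc i) = coeff-xpow-≡ i

coeff-xpow-≢ : ∀ e i → e ≢ i → coeff (xpow e) i ≡ 0ℚ
coeff-xpow-≢ zero    zero    e≢i = contradiction refl e≢i
coeff-xpow-≢ zero    (suc i) _   = refl
coeff-xpow-≢ (suc e) zero    _   = refl
coeff-xpow-≢ (suc e) (suc i) e≢i = coeff-xpow-≢ e i (e≢i ∘ cong suc)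

δ-≢0 : ∀ {n} → n ≢ 0 → δ n ≡ 0ℚ
δ-≢0 {zero}  n≢0 = contradiction refl n≢0
δ-≢0 {suc n} _   = refl

IsLinear-sumP : ∀ {Λ} → IsLinear Λ → ∀ N f → Λ (sumP N f) ≡ ∑[ k ≤ N ] Λ (f k)
IsLinear-sumP     lin zero    f = refl
IsLinear-sumP {Λ} lin (suc N) f =
  trans (IsLinear.additive lin (sumP N f) (f (suc N))) (cong (_+ Λ (f (suc N))) (IsLinear-sumP lin N f))

2*-suc : ∀ k → 2 ℕ.* suc k ≡ suc (suc (2 ℕ.* k))
2*-suc k = cong suc (ℕP.+-suc k (k ℕ.+ 0))

m≡n+o⇒m∸o≡n : ∀ {m n} o → m ≡ n ℕ.+ o → m ∸ o ≡ n
m≡n+o⇒m∸o≡n {n = n} o refl = ℕP.m+n∸n≡m n o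

k≤⌊n/2⌋⇒2k≤n : ∀ {k n} → k ≤ ⌊ n /2⌋ → 2 ℕ.* k ≤ n
k≤⌊n/2⌋⇒2k≤n {k} {n} k≤ = subst (_≤ n) (cong (k ℕ.+_) (sym (ℕP.+-identityʳ k)))
  (subst (k ℕ.+ k ≤_) (ℕP.⌊n/2⌋+⌈n/2⌉≡n n)
    (ℕP.+-mono-≤ k≤ (ℕP.≤-trans k≤ (ℕP.⌊n/2⌋≤⌈n/2⌉ n))))

2k≤n⇒k≤⌊n/2⌋ : ∀ {k n} → 2 ℕ.* k ≤ n → k ≤ ⌊ n /2⌋
2k≤n⇒k≤⌊n/2⌋ {k} {n} 2k≤n = subst (_≤ ⌊ n /2⌋) (sym (ℕP.n≡⌊n+n/2⌋ k))
  (ℕP.⌊n/2⌋-mono (subst (_≤ n) (cong (k ℕ.+_) (ℕP.+-identityʳ k)) 2k≤n))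

offset-of-∸2k∸2t : ∀ {n k t} → k ≤ ⌊ n /2⌋ → t ≤ ⌊ (n ∸ 2 ℕ.* k) /2⌋ →
                   n ≡ (n ∸ 2 ℕ.* k ∸ 2 ℕ.* t) ℕ.+ 2 ℕ.* (k ℕ.+ t)
offset-of-∸2k∸2t {n} {k} {t} k≤ t≤ = begin
  n                                      ≡⟨ ℕP.m∸n+n≡m 2k≤n ⟨
  n ∸ 2 ℕ.* k ℕ.+ 2 ℕ.* k                ≡⟨ cong (ℕ._+ 2 ℕ.* k) (ℕP.m∸n+n≡m (k≤⌊n/2⌋⇒2k≤n t≤)) ⟨
  n ∸ 2 ℕ.* k ∸ 2 ℕ.* t ℕ.+ 2 ℕ.* t ℕ.+ 2 ℕ.* k
    ≡⟨ ℕP.+-assoc (n ∸ 2 ℕ.* k ∸ 2 ℕ.* t) (2 ℕ.* t) (2 ℕ.* k) ⟩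
  n ∸ 2 ℕ.* k ∸ 2 ℕ.* t ℕ.+ (2 ℕ.* t ℕ.+ 2 ℕ.* k)
    ≡⟨ cong ((n ∸ 2 ℕ.* k ∸ 2 ℕ.* t) ℕ.+_) (trans (ℕP.+-comm (2 ℕ.* t) (2 ℕ.* k)) (sym (ℕP.*-distribˡ-+ 2 k t))) ⟩
  n ∸ 2 ℕ.* k ∸ 2 ℕ.* t ℕ.+ 2 ℕ.* (k ℕ.+ t) ∎
  where
  open ≡-Reasoning
  2k≤n = k≤⌊n/2⌋⇒2k≤n k≤

offset? : ∀ n i → (∃[ j ] n ≡ i ℕ.+ 2 ℕ.* j) ⊎ (∀ j → n ≢ i ℕ.+ 2 ℕ.* j)
offset? n (suc i) with n
... | zero  = inj₂ λ _ ()
... | suc n with offset? n i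
...   | inj₁ (j , n≡) = inj₁ (j , cong suc n≡)
...   | inj₂ n≢      = inj₂ λ j → n≢ j ∘ ℕP.suc-injective
offset? zero          zero = inj₁ (0 , refl)
offset? (suc zero)    zero = inj₂ λ j 1≡2j → ℕP.even≢odd j 0 (sym 1≡2j)
offset? (suc (suc n)) zero with offset? n 0
... | inj₁ (j , n≡) = inj₁ (suc j , trans (cong (suc ∘ suc) n≡) (sym (2*-suc j)))
... | inj₂ n≢      = inj₂ λ { zero () ; (suc j) n≡ → n≢ j (ℕP.suc-injective (ℕP.suc-injective (trans n≡ (2*-suc j)))) }

module _ (f : ℕ → ℕ → ℚ) (n i : ℕ) where

  diagonalSum : ℚ
  diagonalSum = ∑[ k ≤ ⌊ n /2⌋ ] ∑[ t ≤ ⌊ (n ∸ 2 ℕ.* k) /2⌋ ] (f k t * coeff (xpow (n ∸ 2 ℕ.* k ∸ 2 ℕ.* t)) i)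

  diagonalSum-off : (∀ j → n ≢ i ℕ.+ 2 ℕ.* j) → diagonalSum ≡ 0ℚ
  diagonalSum-off n≢ = ∑≤-zero ⌊ n /2⌋ λ k k≤ → ∑≤-zero _ λ t t≤ →
    trans (cong (f k t *_) (coeff-xpow-≢ (n ∸ 2 ℕ.* k ∸ 2 ℕ.* t) i λ e≡i →
            n≢ (k ℕ.+ t) (trans (offset-of-∸2k∸2t k≤ t≤) (cong (ℕ._+ 2 ℕ.* (k ℕ.+ t)) e≡i))))
          (ℚP.*-zeroʳ (f k t))

  diagonalSum-on : ∀ {j} → n ≡ i ℕ.+ 2 ℕ.* j → diagonalSum ≡ ∑[ k ≤ j ] f k (j ∸ k)
  diagonalSum-on {j} n≡ =
    trans (∑≤-truncate _ (2k≤n⇒k≤⌊n/2⌋ 2j≤n) λ k j<k k≤ → ∑≤-zero _ λ t t≤ →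
             term≡0 k t k≤ t≤ λ k+t≡j → ℕP.<⇒≱ j<k (subst (k ≤_) k+t≡j (ℕP.m≤m+n k t)))
          (∑≤-cong j λ k k≤j → trans
             (∑≤-single (j ∸ k) _ (t₀≤ k≤j) λ t t≤ t≢ →
               term≡0 k t (ℕP.≤-trans k≤j (2k≤n⇒k≤⌊n/2⌋ 2j≤n)) t≤ λ k+t≡j →
                 t≢ (trans (sym (ℕP.m+n∸m≡n k t)) (cong (_∸ k) k+t≡j)))
             (trans (cong (λ e → f k (j ∸ k) * coeff (xpow e) i) (∸2k∸2[j∸k]≡i k≤j))
                    (trans (cong (f k (j ∸ k) *_) (coeff-xpow-≡ i)) (ℚP.*-identityʳ (f k (j ∸ k))))))
    where
    2j≤n : 2 ℕ.* j ≤ n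
    2j≤n = subst (2 ℕ.* j ≤_) (sym n≡) (ℕP.m≤n+m (2 ℕ.* j) i)

    term≡0 : ∀ k t → k ≤ ⌊ n /2⌋ → t ≤ ⌊ (n ∸ 2 ℕ.* k) /2⌋ → k ℕ.+ t ≢ j →
             f k t * coeff (xpow (n ∸ 2 ℕ.* k ∸ 2 ℕ.* t)) i ≡ 0ℚ
    term≡0 k t k≤ t≤ k+t≢j = trans (cong (f k t *_) (coeff-xpow-≢ (n ∸ 2 ℕ.* k ∸ 2 ℕ.* t) i λ e≡i → k+t≢j
        (ℕP.*-cancelˡ-≡ (k ℕ.+ t) j 2 (ℕP.+-cancelˡ-≡ i _ _
          (trans (sym (trans (offset-of-∸2k∸2t k≤ t≤) (cong (ℕ._+ 2 ℕ.* (k ℕ.+ t)) e≡i))) n≡)))))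
      (ℚP.*-zeroʳ (f k t))

    n∸2k≡i+2[j∸k] : ∀ {k} → k ≤ j → n ∸ 2 ℕ.* k ≡ i ℕ.+ 2 ℕ.* (j ∸ k)
    n∸2k≡i+2[j∸k] {k} k≤j = begin
      n ∸ 2 ℕ.* k                                     ≡⟨ cong (_∸ 2 ℕ.* k) n≡ ⟩
      i ℕ.+ 2 ℕ.* j ∸ 2 ℕ.* k                         ≡⟨ cong (λ x → i ℕ.+ 2 ℕ.* x ∸ 2 ℕ.* k) (ℕP.m+[n∸m]≡n k≤j) ⟨
      i ℕ.+ 2 ℕ.* (k ℕ.+ (j ∸ k)) ∸ 2 ℕ.* k           ≡⟨ cong (_∸ 2 ℕ.* k) (regroup i k (j ∸ k)) ⟩
      i ℕ.+ 2 ℕ.* (j ∸ k) ℕ.+ 2 ℕ.* k ∸ 2 ℕ.* k       ≡⟨ ℕP.m+n∸n≡m _ (2 ℕ.* k) ⟩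
      i ℕ.+ 2 ℕ.* (j ∸ k)                             ∎
      where
      open ≡-Reasoning
      regroup : ∀ i k t → i ℕ.+ 2 ℕ.* (k ℕ.+ t) ≡ i ℕ.+ 2 ℕ.* t ℕ.+ 2 ℕ.* k
      regroup = ℕSolver.solve-∀

    ∸2k∸2[j∸k]≡i : ∀ {k} → k ≤ j → n ∸ 2 ℕ.* k ∸ 2 ℕ.* (j ∸ k) ≡ i
    ∸2k∸2[j∸k]≡i {k} k≤j = trans (cong (_∸ 2 ℕ.* (j ∸ k)) (n∸2k≡i+2[j∸k] k≤j)) (ℕP.m+n∸n≡m i (2 ℕ.* (j ∸ k)))

    t₀≤ : ∀ {k} → k ≤ j → j ∸ k ≤ ⌊ (n ∸ 2 ℕ.* k) /2⌋
    t₀≤ {k} k≤j = 2k≤n⇒k≤⌊n/2⌋ (subst (2 ℕ.* (j ∸ k) ≤_) (sym (n∸2k≡i+2[j∸k] k≤j)) (ℕP.m≤n+m _ i))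

^ℚ-+ : ∀ q a b → (q ^ℚ a) * (q ^ℚ b) ≡ q ^ℚ (a ℕ.+ b)
^ℚ-+ q zero    b = ℚP.*-identityˡ (q ^ℚ b)
^ℚ-+ q (suc a) b = trans (ℚP.*-assoc q (q ^ℚ a) (q ^ℚ b)) (cong (q *_) (^ℚ-+ q a b))

-^ℚ : ∀ q k → (- q) ^ℚ k ≡ sgn k * (q ^ℚ k)
-^ℚ q zero    = sym (ℚP.*-identityˡ 1ℚ)
-^ℚ q (suc k) = trans (cong ((- q) *_) (-^ℚ q k))
  (solve 3 (λ q σ x → (:- q) :* (σ :* x) := (:- σ) :* (q :* x)) refl q (sgn k) (q ^ℚ k))

*-pos : ∀ {a b} → 0 < a → 0 < b → 0 < a ℕ.* b
*-pos = ℕP.*-mono-≤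

!-pos : ∀ n → 0 < n !
!-pos = ℕP.1≤n!

prodD-falling : ∀ m n a t → m ℕ.+ n ≡ suc (a ℕ.+ t) → a ! ℕ.* prodD m n t ≡ (a ℕ.+ t) !
prodD-falling m n a zero    _  = trans (ℕP.*-identityʳ (a !)) (cong _! (sym (ℕP.+-identityʳ a)))
prodD-falling m n a (suc t) eq = begin
  a ! ℕ.* (prodD m n t ℕ.* (m ℕ.+ n ∸ suc t))  ≡⟨ cong (λ x → a ! ℕ.* (prodD m n t ℕ.* x)) top ⟩
  a ! ℕ.* (prodD m n t ℕ.* suc a)              ≡⟨ reorder (a !) (prodD m n t) (suc a) ⟩
  suc a ! ℕ.* prodD m n t                      ≡⟨ prodD-falling m n (suc a) t (trans eq (cong suc (ℕP.+-suc a t))) ⟩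
  (suc a ℕ.+ t) !                              ≡⟨ cong _! (ℕP.+-suc a t) ⟨
  (a ℕ.+ suc t) !                              ∎
  where
  open ≡-Reasoning
  top : m ℕ.+ n ∸ suc t ≡ suc a
  top = trans (cong (_∸ suc t) (trans eq (cong suc (ℕP.+-suc a t)))) (ℕP.m+n∸n≡m (suc a) t)
  reorder : ∀ x p y → x ℕ.* (p ℕ.* y) ≡ y ℕ.* x ℕ.* p
  reorder = ℕSolver.solve-∀

prodD-pos : ∀ m n a t → m ℕ.+ n ≡ suc (a ℕ.+ t) → 0 < prodD m n t
prodD-pos m n a t eq = ℕP.n≢0⇒n>0 λ P≡0 →
  ℕP.<⇒≢ (!-pos (a ℕ.+ t)) (trans (sym (ℕP.*-zeroʳ (a !))) (trans (cong (a ! ℕ.*_) (sym P≡0)) (prodD-falling m n a t eq)))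

xRatio : ℕ → ℕ → ℕ → ℚ
xRatio m n k = frac ((n !) ℕ.* ((n ℕ.+ m ∸ 2 ℕ.* k) !)) ((k !) ℕ.* ((n ∸ 2 ℕ.* k) !) ℕ.* ((n ℕ.+ m ∸ k) !))

lRatio : ℕ → ℕ → ℕ → ℚ
lRatio m n t = frac (n !) ((t !) ℕ.* ((n ∸ 2 ℕ.* t) !) ℕ.* prodD m n t)

-- h M j k = C(j-1,k-1) (M+j-k)! / (M+2j-k)!; the factors k and suc j ∸ k make it vanish at
-- k = 0 and k = j + 1, the two ends of the telescope.
h : ℕ → ℕ → ℕ → ℚ
h M j k = frac (k ℕ.* (suc j ∸ k) ℕ.* (j ∸ 1) ! ℕ.* ((j ∸ k) ℕ.+ M) !)
               (k ! ℕ.* (suc j ∸ k) ! ℕ.* ((j ∸ k) ℕ.+ M ℕ.+ j) !)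

h-split : ∀ {M j} k t → k ℕ.+ t ≡ j →
          h M j k ≡ frac (k ℕ.* suc t ℕ.* (j ∸ 1) ! ℕ.* (t ℕ.+ M) !) (k ! ℕ.* suc t ! ℕ.* (t ℕ.+ M ℕ.+ j) !)
h-split {M} k t refl = cong₂ (λ x y → frac (k ℕ.* y ℕ.* (k ℕ.+ t ∸ 1) ! ℕ.* (x ℕ.+ M) !)
                                          (k ! ℕ.* y ! ℕ.* (x ℕ.+ M ℕ.+ (k ℕ.+ t)) !))
  (ℕP.m+n∸m≡n k t) (trans (cong (_∸ k) (sym (ℕP.+-suc k t))) (ℕP.m+n∸m≡n k (suc t)))

h-beyond : ∀ M j → h M j (suc j) ≡ 0ℚ
h-beyond M j = trans (cong (λ a → frac a denominator) numerator≡0) (frac-0 denominator)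
  where
  denominator = suc j ! ℕ.* (j ∸ j) ! ℕ.* ((j ∸ suc j) ℕ.+ M ℕ.+ j) !
  numerator≡0 : suc j ℕ.* (j ∸ j) ℕ.* (j ∸ 1) ! ℕ.* ((j ∸ suc j) ℕ.+ M) ! ≡ 0
  numerator≡0 rewrite ℕP.n∸n≡0 j | ℕP.*-zeroʳ j = refl

h-0 : ∀ M j → h M j 0 ≡ 0ℚ
h-0 M j = frac-0 (0 ! ℕ.* (suc j ∸ 0) ! ℕ.* ((j ∸ 0) ℕ.+ M ℕ.+ j) !)

h+h-suc : ∀ M k T → let j = suc (k ℕ.+ T) in
  h M j k + h M j (suc k) ≡ frac (j ℕ.* suc (suc (T ℕ.+ T ℕ.+ M)) ℕ.* (k ℕ.+ T) ! ℕ.* (T ℕ.+ M) !)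
                                 (k ! ℕ.* suc T ! ℕ.* suc (T ℕ.+ M ℕ.+ j) !)
h+h-suc M k T = begin
  h M j k + h M j (suc k)
    ≡⟨ cong₂ _+_ (h-split k (suc T) (ℕP.+-suc k T)) (h-split (suc k) T refl) ⟩
  frac (k ℕ.* suc (suc T) ℕ.* (k ℕ.+ T) ! ℕ.* (suc T ℕ.+ M) !) (k ! ℕ.* suc (suc T) ! ℕ.* (suc T ℕ.+ M ℕ.+ j) !) +
  frac (suc k ℕ.* suc T ℕ.* (k ℕ.+ T) ! ℕ.* (T ℕ.+ M) !) (suc k ! ℕ.* suc T ! ℕ.* (T ℕ.+ M ℕ.+ j) !)
    ≡⟨ trans (frac-+ _ _ _ _ b>0 d>0)
             (frac-cong (*-pos b>0 d>0) (*-pos (*-pos (!-pos k) (!-pos (suc T))) (!-pos (suc (T ℕ.+ M ℕ.+ j))))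
                        (cross k T M (k !) (T !) ((k ℕ.+ T) !) ((T ℕ.+ M) !) ((T ℕ.+ M ℕ.+ j) !))) ⟩
  frac (j ℕ.* suc (suc (T ℕ.+ T ℕ.+ M)) ℕ.* (k ℕ.+ T) ! ℕ.* (T ℕ.+ M) !)
       (k ! ℕ.* suc T ! ℕ.* suc (T ℕ.+ M ℕ.+ j) !) ∎
  where
  open ≡-Reasoning
  j = suc (k ℕ.+ T)
  b>0 = *-pos (*-pos (!-pos k) (!-pos (suc (suc T)))) (!-pos (suc T ℕ.+ M ℕ.+ j))
  d>0 = *-pos (*-pos (!-pos (suc k)) (!-pos (suc T))) (!-pos (T ℕ.+ M ℕ.+ j))
  -- k (M + t) + t (M + t + j) = j (M + 2t), with t = T + 1 and j = k + t
  cross : ∀ k T M K Tf J A B → let j = suc (k ℕ.+ T) ; S = suc (T ℕ.+ M ℕ.+ j) in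
    ((k ℕ.* suc (suc T) ℕ.* J ℕ.* (suc (T ℕ.+ M) ℕ.* A)) ℕ.* (suc k ℕ.* K ℕ.* (suc T ℕ.* Tf) ℕ.* B) ℕ.+
     (suc k ℕ.* suc T ℕ.* J ℕ.* A) ℕ.* (K ℕ.* (suc (suc T) ℕ.* (suc T ℕ.* Tf)) ℕ.* (S ℕ.* B)))
    ℕ.* (K ℕ.* (suc T ℕ.* Tf) ℕ.* (S ℕ.* B))
    ≡ j ℕ.* suc (suc (T ℕ.+ T ℕ.+ M)) ℕ.* J ℕ.* A
      ℕ.* ((K ℕ.* (suc (suc T) ℕ.* (suc T ℕ.* Tf)) ℕ.* (S ℕ.* B)) ℕ.* (suc k ℕ.* K ℕ.* (suc T ℕ.* Tf) ℕ.* B))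
  cross = ℕSolver.solve-∀

xRatio-0 : ∀ m n → xRatio m n 0 ≡ 1ℚ
xRatio-0 m n = frac-cong {n ! ℕ.* (n ℕ.+ m) !} {1 ℕ.* n ! ℕ.* (n ℕ.+ m) !} {1} {1}
  (*-pos (*-pos {1} (s≤s z≤n) (!-pos n)) (!-pos (n ℕ.+ m))) (s≤s z≤n) (units (n !) ((n ℕ.+ m) !))
  where
  units : ∀ x y → x ℕ.* y ℕ.* 1 ≡ 1 ℕ.* (1 ℕ.* x ℕ.* y)
  units = ℕSolver.solve-∀

xRatio-diagonal : ∀ m N → xRatio m (2 ℕ.* N) N ≡ frac ((2 ℕ.* N) ! ℕ.* m !) (N ! ℕ.* (m ℕ.+ N) !)
xRatio-diagonal m N = begin
  frac ((2 ℕ.* N) ! ℕ.* (2 ℕ.* N ℕ.+ m ∸ 2 ℕ.* N) !) (N ! ℕ.* (2 ℕ.* N ∸ 2 ℕ.* N) ! ℕ.* (2 ℕ.* N ℕ.+ m ∸ N) !)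
    ≡⟨ cong₂ (λ x y → frac ((2 ℕ.* N) ! ℕ.* x !) (N ! ℕ.* y ! ℕ.* (2 ℕ.* N ℕ.+ m ∸ N) !))
             (ℕP.m+n∸m≡n (2 ℕ.* N) m) (ℕP.n∸n≡0 (2 ℕ.* N)) ⟩
  frac ((2 ℕ.* N) ! ℕ.* m !) (N ! ℕ.* 1 ℕ.* (2 ℕ.* N ℕ.+ m ∸ N) !)
    ≡⟨ cong₂ (λ x y → frac ((2 ℕ.* N) ! ℕ.* m !) (x ℕ.* y !)) (ℕP.*-identityʳ (N !))
             (trans (cong (_∸ N) (regroup m N)) (ℕP.m+n∸n≡m (m ℕ.+ N) N)) ⟩
  frac ((2 ℕ.* N) ! ℕ.* m !) (N ! ℕ.* (m ℕ.+ N) !) ∎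
  where
  open ≡-Reasoning
  regroup : ∀ m N → 2 ℕ.* N ℕ.+ m ≡ m ℕ.+ N ℕ.+ N
  regroup = ℕSolver.solve-∀

lRatio-0 : ∀ m n → lRatio m n 0 ≡ 1ℚ
lRatio-0 m n = frac-cong {n !} {1 ℕ.* n ! ℕ.* 1} {1} {1} (*-pos (*-pos {1} (s≤s z≤n) (!-pos n)) (s≤s z≤n)) (s≤s z≤n)
  (units (n !))
  where
  units : ∀ x → x ℕ.* 1 ≡ 1 ℕ.* (1 ℕ.* x ℕ.* 1)
  units = ℕSolver.solve-∀

module _ (m i : ℕ) where

  private
    M = m ℕ.+ i

  xRatio*lRatio-end : ∀ j′ → let j = suc j′ ; n = i ℕ.+ 2 ℕ.* j in
    xRatio m n j * lRatio m (n ∸ 2 ℕ.* j) 0 ≡ frac (n !) (j ! ℕ.* i !) * (h M j j + h M j (suc j))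
  xRatio*lRatio-end j′ = begin
    xRatio m n j * lRatio m (n ∸ 2 ℕ.* j) 0
      ≡⟨ cong₂ _*_ (xRatio-at (m≡n+o⇒m∸o≡n (2 ℕ.* j) (regroup i m j)) (ℕP.m+n∸n≡m i (2 ℕ.* j))
                           (m≡n+o⇒m∸o≡n j (regroup′ i m j)))
                   (lRatio-0 m (n ∸ 2 ℕ.* j)) ⟩
    frac (n ! ℕ.* M !) (j ! ℕ.* i ! ℕ.* (M ℕ.+ j) !) * 1ℚ
      ≡⟨ ℚP.*-identityʳ _ ⟩
    frac (n ! ℕ.* M !) (j ! ℕ.* i ! ℕ.* (M ℕ.+ j) !)
      ≡⟨ frac-cong (*-pos (*-pos (!-pos j) (!-pos i)) (!-pos (M ℕ.+ j)))
                   (*-pos (*-pos (!-pos j) (!-pos i)) (*-pos (*-pos (!-pos j) (s≤s z≤n)) (!-pos (M ℕ.+ j))))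
                   (cross j′ (n !) (j′ !) (i !) (M !) ((M ℕ.+ j) !)) ⟩
    frac (n ! ℕ.* (j ℕ.* 1 ℕ.* j′ ! ℕ.* M !)) ((j ! ℕ.* i !) ℕ.* (j ! ℕ.* 1 ℕ.* (M ℕ.+ j) !))
      ≡⟨ frac-* (n !) (j ! ℕ.* i !) _ _ ⟨
    frac (n !) (j ! ℕ.* i !) * frac (j ℕ.* 1 ℕ.* j′ ! ℕ.* M !) (j ! ℕ.* 1 ℕ.* (M ℕ.+ j) !)
      ≡⟨ cong (frac (n !) (j ! ℕ.* i !) *_) (sym (trans (cong₂ _+_ (h-split j 0 (ℕP.+-identityʳ j)) (h-beyond M j))
                                                      (ℚP.+-identityʳ _))) ⟩
    frac (n !) (j ! ℕ.* i !) * (h M j j + h M j (suc j)) ∎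
    where
    open ≡-Reasoning
    j = suc j′
    n = i ℕ.+ 2 ℕ.* j
    xRatio-at : ∀ {x y z} → n ℕ.+ m ∸ 2 ℕ.* j ≡ x → n ∸ 2 ℕ.* j ≡ y → n ℕ.+ m ∸ j ≡ z →
             xRatio m n j ≡ frac (n ! ℕ.* x !) (j ! ℕ.* y ! ℕ.* z !)
    xRatio-at refl refl refl = refl
    regroup : ∀ i m j → i ℕ.+ 2 ℕ.* j ℕ.+ m ≡ m ℕ.+ i ℕ.+ 2 ℕ.* j
    regroup = ℕSolver.solve-∀
    regroup′ : ∀ i m j → i ℕ.+ 2 ℕ.* j ℕ.+ m ≡ m ℕ.+ i ℕ.+ j ℕ.+ j
    regroup′ = ℕSolver.solve-∀
    cross : ∀ j′ N J I A B → N ℕ.* A ℕ.* ((suc j′ ℕ.* J ℕ.* I) ℕ.* (suc j′ ℕ.* J ℕ.* 1 ℕ.* B))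
                            ≡ N ℕ.* (suc j′ ℕ.* 1 ℕ.* J ℕ.* A) ℕ.* (suc j′ ℕ.* J ℕ.* I ℕ.* B)
    cross = ℕSolver.solve-∀

  module _ (k T : ℕ) where

    private
      j = suc (k ℕ.+ T)
      t = suc T
      n = i ℕ.+ 2 ℕ.* j

    n∸2k≡i+2t : n ∸ 2 ℕ.* k ≡ i ℕ.+ 2 ℕ.* t
    n∸2k≡i+2t = m≡n+o⇒m∸o≡n (2 ℕ.* k) (regroup i k T)
      where
      regroup : ∀ i k T → i ℕ.+ 2 ℕ.* suc (k ℕ.+ T) ≡ i ℕ.+ 2 ℕ.* suc T ℕ.+ 2 ℕ.* k
      regroup = ℕSolver.solve-∀

    n+m∸2k≡ : n ℕ.+ m ∸ 2 ℕ.* k ≡ suc (T ℕ.+ M ℕ.+ t)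
    n+m∸2k≡ = m≡n+o⇒m∸o≡n (2 ℕ.* k) (regroup i m k T)
      where
      regroup : ∀ i m k T → i ℕ.+ 2 ℕ.* suc (k ℕ.+ T) ℕ.+ m ≡ suc (T ℕ.+ (m ℕ.+ i) ℕ.+ suc T) ℕ.+ 2 ℕ.* k
      regroup = ℕSolver.solve-∀

    n+m∸k≡ : n ℕ.+ m ∸ k ≡ suc (T ℕ.+ M ℕ.+ j)
    n+m∸k≡ = m≡n+o⇒m∸o≡n k (regroup i m k T)
      where
      regroup : ∀ i m k T → i ℕ.+ 2 ℕ.* suc (k ℕ.+ T) ℕ.+ m ≡ suc (T ℕ.+ (m ℕ.+ i) ℕ.+ suc (k ℕ.+ T)) ℕ.+ k
      regroup = ℕSolver.solve-∀

    m+[n∸2k]≡ : m ℕ.+ (n ∸ 2 ℕ.* k) ≡ suc (T ℕ.+ M ℕ.+ t)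
    m+[n∸2k]≡ = trans (cong (m ℕ.+_) n∸2k≡i+2t) (regroup m i T)
      where
      regroup : ∀ m i T → m ℕ.+ (i ℕ.+ 2 ℕ.* suc T) ≡ suc (T ℕ.+ (m ℕ.+ i) ℕ.+ suc T)
      regroup = ℕSolver.solve-∀

    xRatio*lRatio-interior :
      xRatio m n k * lRatio m (n ∸ 2 ℕ.* k) t ≡ frac (n !) (j ! ℕ.* i !) * (h M j k + h M j (suc k))
    xRatio*lRatio-interior = begin
      xRatio m n k * lRatio m X t
        ≡⟨ cong₂ _*_ (cong₂ (λ x y → frac (n ! ℕ.* x !) (k ! ℕ.* X ! ℕ.* y !)) n+m∸2k≡ n+m∸k≡)
                     (cong (λ x → frac (X !) (t ! ℕ.* x ! ℕ.* P)) (m≡n+o⇒m∸o≡n (2 ℕ.* t) n∸2k≡i+2t)) ⟩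
      frac (n ! ℕ.* suc (a ℕ.+ t) !) (k ! ℕ.* X ! ℕ.* suc (a ℕ.+ j) !) * frac (X !) (t ! ℕ.* i ! ℕ.* P)
        ≡⟨ frac-* (n ! ℕ.* suc (a ℕ.+ t) !) (k ! ℕ.* X ! ℕ.* suc (a ℕ.+ j) !) (X !) (t ! ℕ.* i ! ℕ.* P) ⟩
      frac (n ! ℕ.* suc (a ℕ.+ t) ! ℕ.* X !) ((k ! ℕ.* X ! ℕ.* suc (a ℕ.+ j) !) ℕ.* (t ! ℕ.* i ! ℕ.* P))
        ≡⟨ frac-cong (*-pos (*-pos (*-pos (!-pos k) (!-pos X)) (!-pos (suc (a ℕ.+ j))))
                            (*-pos (*-pos (!-pos t) (!-pos i)) (prodD-pos m X a t m+[n∸2k]≡)))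
                     (*-pos (*-pos (!-pos j) (!-pos i)) (*-pos (*-pos (!-pos k) (!-pos t)) (!-pos (suc (a ℕ.+ j)))))
                     (cross k T M (n !) (X !) (i !) (k !) (T !) ((k ℕ.+ T) !) (a !) ((a ℕ.+ j) !) P ((a ℕ.+ t) !)
                            (sym (prodD-falling m X a t m+[n∸2k]≡))) ⟩
      frac (n ! ℕ.* hNum) ((j ! ℕ.* i !) ℕ.* hDen)
        ≡⟨ frac-* (n !) (j ! ℕ.* i !) hNum hDen ⟨
      frac (n !) (j ! ℕ.* i !) * frac hNum hDen
        ≡⟨ cong (frac (n !) (j ! ℕ.* i !) *_) (h+h-suc M k T) ⟨
      frac (n !) (j ! ℕ.* i !) * (h M j k + h M j (suc k)) ∎
      where
      open ≡-Reasoning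
      X = n ∸ 2 ℕ.* k
      a = T ℕ.+ M
      P = prodD m X t
      hNum = j ℕ.* suc (suc (T ℕ.+ T ℕ.+ M)) ℕ.* (k ℕ.+ T) ! ℕ.* a !
      hDen = k ! ℕ.* t ! ℕ.* suc (a ℕ.+ j) !
      -- the falling factorial P in the denominator cancels against (a + t)! = a! P
      cross : ∀ k T M N Xf I K Tf J A B P F → F ≡ A ℕ.* P → let j = suc (k ℕ.+ T) ; S = suc (T ℕ.+ M ℕ.+ j) in
        N ℕ.* (suc (T ℕ.+ M ℕ.+ suc T) ℕ.* F) ℕ.* Xf
          ℕ.* ((j ℕ.* J ℕ.* I) ℕ.* (K ℕ.* (suc T ℕ.* Tf) ℕ.* (S ℕ.* B)))
        ≡ N ℕ.* (j ℕ.* suc (suc (T ℕ.+ T ℕ.+ M)) ℕ.* J ℕ.* A)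
          ℕ.* ((K ℕ.* Xf ℕ.* (S ℕ.* B)) ℕ.* ((suc T ℕ.* Tf) ℕ.* I ℕ.* P))
      cross k T M N Xf I K Tf J A B P _ refl = cross′ k T M N Xf I K Tf J A B P
        where
        cross′ : ∀ k T M N Xf I K Tf J A B P → let j = suc (k ℕ.+ T) ; S = suc (T ℕ.+ M ℕ.+ j) in
          N ℕ.* (suc (T ℕ.+ M ℕ.+ suc T) ℕ.* (A ℕ.* P)) ℕ.* Xf
            ℕ.* ((j ℕ.* J ℕ.* I) ℕ.* (K ℕ.* (suc T ℕ.* Tf) ℕ.* (S ℕ.* B)))
          ≡ N ℕ.* (j ℕ.* suc (suc (T ℕ.+ T ℕ.+ M)) ℕ.* J ℕ.* A)
            ℕ.* ((K ℕ.* Xf ℕ.* (S ℕ.* B)) ℕ.* ((suc T ℕ.* Tf) ℕ.* I ℕ.* P))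
        cross′ = ℕSolver.solve-∀

  xRatio*lRatio : ∀ j′ k → k ≤ suc j′ → let j = suc j′ ; n = i ℕ.+ 2 ℕ.* j in
    xRatio m n k * lRatio m (n ∸ 2 ℕ.* k) (j ∸ k) ≡ frac (n !) (j ! ℕ.* i !) * (h M j k + h M j (suc k))
  xRatio*lRatio j′ k k≤j with ℕP.m≤n⇒m<n∨m≡n k≤j
  ... | inj₂ refl = trans (cong (xRatio*lRatio-at k) (ℕP.n∸n≡0 k)) (xRatio*lRatio-end j′)
    where n = i ℕ.+ 2 ℕ.* k
          xRatio*lRatio-at = λ k t → xRatio m n k * lRatio m (n ∸ 2 ℕ.* k) t
  ... | inj₁ (s≤s k≤j′) with ℕP.m≤n⇒∃[o]m+o≡n k≤j′
  ...   | T , refl = trans (cong (xRatio*lRatio-at k) (trans (cong (_∸ k) (sym (ℕP.+-suc k T))) (ℕP.m+n∸m≡n k (suc T))))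
                           (xRatio*lRatio-interior k T)
    where n = i ℕ.+ 2 ℕ.* suc (k ℕ.+ T)
          xRatio*lRatio-at = λ k t → xRatio m n k * lRatio m (n ∸ 2 ℕ.* k) t

module _ (m : ℕ) (s : ℚ) where

  xCoeff : ℕ → ℕ → ℚ
  xCoeff n k = xRatio m n k * ((- s) ^ℚ k)

  lCoeff : ℕ → ℕ → ℚ
  lCoeff n t = lRatio m n t * (s ^ℚ t)

  xCoeff*lCoeff : ℕ → ℕ → ℕ → ℚ
  xCoeff*lCoeff n k t = xCoeff n k * lCoeff (n ∸ 2 ℕ.* k) t

  ∑-xCoeff*lCoeff : ∀ i j → let n = i ℕ.+ 2 ℕ.* j in ∑[ k ≤ j ] xCoeff*lCoeff n k (j ∸ k) ≡ δ j
  ∑-xCoeff*lCoeff i zero = cong₂ (λ x y → (x * 1ℚ) * (y * 1ℚ)) (xRatio-0 m i′) (lRatio-0 m i′)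
    where i′ = i ℕ.+ 2 ℕ.* 0
  ∑-xCoeff*lCoeff i (suc j′) = begin
    ∑[ k ≤ j ] (xCoeff n k * lCoeff (n ∸ 2 ℕ.* k) (j ∸ k))
      ≡⟨ ∑≤-cong j (λ k k≤j → term k k≤j) ⟩
    ∑[ k ≤ j ] (c * (sgn k * (h M j k + h M j (suc k))))
      ≡⟨ *-distribˡ-∑≤ c j (λ k → sgn k * (h M j k + h M j (suc k))) ⟨
    c * ∑[ k ≤ j ] (sgn k * (h M j k + h M j (suc k)))
      ≡⟨ cong (c *_) (∑≤-alternating-telescope j (h M j)) ⟩
    c * (h M j 0 + sgn j * h M j (suc j))
      ≡⟨ cong₂ (λ x y → c * (x + sgn j * y)) (h-0 M j) (h-beyond M j) ⟩
    c * (0ℚ + sgn j * 0ℚ)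
      ≡⟨ solve 2 (λ c σ → c :* (con 0ℚ :+ σ :* con 0ℚ) := con 0ℚ) refl c (sgn j) ⟩
    0ℚ ∎
    where
    open ≡-Reasoning
    j = suc j′
    n = i ℕ.+ 2 ℕ.* j
    M = m ℕ.+ i
    c = (s ^ℚ j) * frac (n !) (j ! ℕ.* i !)
    term : ∀ k → k ≤ j → xCoeff n k * lCoeff (n ∸ 2 ℕ.* k) (j ∸ k) ≡ c * (sgn k * (h M j k + h M j (suc k)))
    term k k≤j = begin
      xRatio m n k * ((- s) ^ℚ k) * (lRatio m (n ∸ 2 ℕ.* k) (j ∸ k) * s ^ℚ (j ∸ k))
        ≡⟨ cong (λ x → xRatio m n k * x * (lRatio m (n ∸ 2 ℕ.* k) (j ∸ k) * s ^ℚ (j ∸ k))) (-^ℚ s k) ⟩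
      xRatio m n k * (sgn k * s ^ℚ k) * (lRatio m (n ∸ 2 ℕ.* k) (j ∸ k) * s ^ℚ (j ∸ k))
        ≡⟨ solve 5 (λ x σ p l q → (x :* (σ :* p)) :* (l :* q) := (x :* l) :* (σ :* (p :* q)))
                 refl (xRatio m n k) (sgn k) (s ^ℚ k) (lRatio m (n ∸ 2 ℕ.* k) (j ∸ k)) (s ^ℚ (j ∸ k)) ⟩
      xRatio m n k * lRatio m (n ∸ 2 ℕ.* k) (j ∸ k) * (sgn k * (s ^ℚ k * s ^ℚ (j ∸ k)))
        ≡⟨ cong₂ (λ x y → x * (sgn k * y)) (xRatio*lRatio m i j′ k k≤j)
                 (trans (^ℚ-+ s k (j ∸ k)) (cong (s ^ℚ_) (ℕP.m+[n∸m]≡n k≤j))) ⟩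
      frac (n !) (j ! ℕ.* i !) * H * (sgn k * s ^ℚ j)
        ≡⟨ solve 4 (λ F H σ p → (F :* H) :* (σ :* p) := (p :* F) :* (σ :* H))
                 refl (frac (n !) (j ! ℕ.* i !)) H (sgn k) (s ^ℚ j) ⟩
      c * (sgn k * H) ∎
      where H = h M j k + h M j (suc k)

  coeff-xpow-offset : ∀ i j → coeff (xpow (i ℕ.+ 2 ℕ.* j)) i ≡ δ j
  coeff-xpow-offset i zero    = trans (cong (λ e → coeff (xpow e) i) (ℕP.+-identityʳ i)) (coeff-xpow-≡ i)
  coeff-xpow-offset i (suc j) = coeff-xpow-≢ (i ℕ.+ 2 ℕ.* suc j) i (ℕP.m+1+n≢m i)

  coeff-lPoly : ∀ n i → coeff (lPoly n m s) i ≡ ∑[ t ≤ ⌊ n /2⌋ ] (lCoeff n t * coeff (xpow (n ∸ 2 ℕ.* t)) i)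
  coeff-lPoly n i = trans (coeff-sumP ⌊ n /2⌋ _ i)
    (∑≤-cong ⌊ n /2⌋ λ t _ → coeff-·ₚ (lCoeff n t) (xpow (n ∸ 2 ℕ.* t)) i)

  diagonalSum-xCoeff*lCoeff : ∀ n i → diagonalSum (xCoeff*lCoeff n) n i ≡ coeff (xpow n) i
  diagonalSum-xCoeff*lCoeff n i with offset? n i
  ... | inj₁ (j , refl) = trans (diagonalSum-on (xCoeff*lCoeff (i ℕ.+ 2 ℕ.* j)) (i ℕ.+ 2 ℕ.* j) i {j} refl)
                                (trans (∑-xCoeff*lCoeff i j) (sym (coeff-xpow-offset i j)))
  ... | inj₂ n≢         = trans (diagonalSum-off (xCoeff*lCoeff n) n i n≢)
                                (sym (coeff-xpow-≢ n i λ n≡i → n≢ 0 (trans n≡i (sym (ℕP.+-identityʳ i)))))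

  xpow-expansion : ∀ n → xpow n ≈ₚ sumP ⌊ n /2⌋ (λ k → xCoeff n k ·ₚ lPoly (n ∸ 2 ℕ.* k) m s)
  xpow-expansion n i = sym (trans coeff-expansion (diagonalSum-xCoeff*lCoeff n i))
    where
    coeff-expansion : coeff (sumP ⌊ n /2⌋ (λ k → xCoeff n k ·ₚ lPoly (n ∸ 2 ℕ.* k) m s)) i
                      ≡ diagonalSum (xCoeff*lCoeff n) n i
    coeff-expansion = trans (coeff-sumP ⌊ n /2⌋ _ i) (∑≤-cong ⌊ n /2⌋ λ k _ → begin
      coeff (xCoeff n k ·ₚ lPoly (n ∸ 2 ℕ.* k) m s) i
        ≡⟨ coeff-·ₚ (xCoeff n k) (lPoly (n ∸ 2 ℕ.* k) m s) i ⟩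
      xCoeff n k * coeff (lPoly (n ∸ 2 ℕ.* k) m s) i
        ≡⟨ cong (xCoeff n k *_) (coeff-lPoly (n ∸ 2 ℕ.* k) i) ⟩
      xCoeff n k * ∑[ t ≤ ⌊ (n ∸ 2 ℕ.* k) /2⌋ ] (lCoeff (n ∸ 2 ℕ.* k) t * coeff (xpow (n ∸ 2 ℕ.* k ∸ 2 ℕ.* t)) i)
        ≡⟨ *-distribˡ-∑≤ (xCoeff n k) ⌊ (n ∸ 2 ℕ.* k) /2⌋ _ ⟩
      ∑[ t ≤ ⌊ (n ∸ 2 ℕ.* k) /2⌋ ] (xCoeff n k * (lCoeff (n ∸ 2 ℕ.* k) t * coeff (xpow (n ∸ 2 ℕ.* k ∸ 2 ℕ.* t)) i))
        ≡⟨ ∑≤-cong ⌊ (n ∸ 2 ℕ.* k) /2⌋ (λ t _ → sym (ℚP.*-assoc (xCoeff n k) (lCoeff (n ∸ 2 ℕ.* k) t)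
                                                             (coeff (xpow (n ∸ 2 ℕ.* k ∸ 2 ℕ.* t)) i))) ⟩
      ∑[ t ≤ ⌊ (n ∸ 2 ℕ.* k) /2⌋ ] (xCoeff n k * lCoeff (n ∸ 2 ℕ.* k) t * coeff (xpow (n ∸ 2 ℕ.* k ∸ 2 ℕ.* t)) i) ∎)
      where open ≡-Reasoning

  module _ {Λ : Poly → ℚ} (lin : IsLinear Λ) (Λ-l : ∀ n → Λ (lPoly n m s) ≡ δ n) where
    open IsLinear lin

    Λ-xpow : ∀ n → Λ (xpow n) ≡ ∑[ k ≤ ⌊ n /2⌋ ] (xCoeff n k * δ (n ∸ 2 ℕ.* k))
    Λ-xpow n = trans (respects _ _ (xpow-expansion n))
      (trans (IsLinear-sumP lin ⌊ n /2⌋ _)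
             (∑≤-cong ⌊ n /2⌋ λ k _ → trans (homogeneous (xCoeff n k) (lPoly (n ∸ 2 ℕ.* k) m s))
                                             (cong (xCoeff n k *_) (Λ-l (n ∸ 2 ℕ.* k)))))

    Λ-xpow-odd : ∀ N → Λ (xpow (2 ℕ.* N ℕ.+ 1)) ≡ 0ℚ
    Λ-xpow-odd N = trans (Λ-xpow (2 ℕ.* N ℕ.+ 1)) (∑≤-zero _ λ k k≤ →
      trans (cong (xCoeff (2 ℕ.* N ℕ.+ 1) k *_) (δ-≢0 λ n∸2k≡0 →
               ℕP.even≢odd k N (trans (ℕP.≤-antisym (k≤⌊n/2⌋⇒2k≤n k≤) (ℕP.m∸n≡0⇒m≤n n∸2k≡0))
                                      (ℕP.+-comm (2 ℕ.* N) 1))))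
            (ℚP.*-zeroʳ (xCoeff (2 ℕ.* N ℕ.+ 1) k)))

    Λ-xpow-even : ∀ N → Λ (xpow (2 ℕ.* N)) ≡ ((- s) ^ℚ N) * frac (((2 ℕ.* N) !) ℕ.* (m !)) ((N !) ℕ.* ((m ℕ.+ N) !))
    Λ-xpow-even N = trans (Λ-xpow (2 ℕ.* N)) (trans
      (∑≤-single N _ (2k≤n⇒k≤⌊n/2⌋ ℕP.≤-refl) λ k k≤ k≢N →
        trans (cong (xCoeff (2 ℕ.* N) k *_) (δ-≢0 λ n∸2k≡0 → k≢N (ℕP.*-cancelˡ-≡ k N 2
                 (ℕP.≤-antisym (k≤⌊n/2⌋⇒2k≤n k≤) (ℕP.m∸n≡0⇒m≤n n∸2k≡0)))))
              (ℚP.*-zeroʳ (xCoeff (2 ℕ.* N) k)))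
      (begin
        xCoeff (2 ℕ.* N) N * δ (2 ℕ.* N ∸ 2 ℕ.* N)
          ≡⟨ cong (λ x → xCoeff (2 ℕ.* N) N * δ x) (ℕP.n∸n≡0 (2 ℕ.* N)) ⟩
        xRatio m (2 ℕ.* N) N * ((- s) ^ℚ N) * 1ℚ
          ≡⟨ ℚP.*-identityʳ (xCoeff (2 ℕ.* N) N) ⟩
        xRatio m (2 ℕ.* N) N * ((- s) ^ℚ N)
          ≡⟨ ℚP.*-comm (xRatio m (2 ℕ.* N) N) ((- s) ^ℚ N) ⟩
        ((- s) ^ℚ N) * xRatio m (2 ℕ.* N) N
          ≡⟨ cong ((- s) ^ℚ N *_) (xRatio-diagonal m N) ⟩
        ((- s) ^ℚ N) * frac ((2 ℕ.* N) ! ℕ.* m !) (N ! ℕ.* (m ℕ.+ N) !) ∎))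
      where open ≡-Reasoning

mainTheorem2 : (m : ℕ) (s : ℚ) →
    ((n : ℕ) → xpow n ≈ₚ sumP ⌊ n /2⌋ (λ k →
        (frac ((n !) ℕ.* ((n ℕ.+ m ∸ 2 ℕ.* k) !)) ((k !) ℕ.* ((n ∸ 2 ℕ.* k) !) ℕ.* ((n ℕ.+ m ∸ k) !))
          * ((- s) ^ℚ k)) ·ₚ lPoly (n ∸ 2 ℕ.* k) m s))
    × ((Λ : Poly → ℚ) → IsLinear Λ → ((n : ℕ) → Λ (lPoly n m s) ≡ δ n) →
        (n : ℕ) → (Λ (xpow (2 ℕ.* n ℕ.+ 1)) ≡ 0ℚ)
          × (Λ (xpow (2 ℕ.* n)) ≡ ((- s) ^ℚ n) * frac (((2 ℕ.* n) !) ℕ.* (m !)) ((n !) ℕ.* ((m ℕ.+ n) !))))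
mainTheorem2 m s = xpow-expansion m s , λ Λ lin Λ-l n → Λ-xpow-odd m s lin Λ-l n , Λ-xpow-even m s lin Λ-l n
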